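{- Fix $T\in\{B,S\}$. Let $C$ be a finite set, and for all natural numbers $x<y$ let $E_{x,y}\subseteq\mathbb N^C$ be a finite nonempty set of vectors. Then there exist a family $\Theta\subseteq\mathcal P(C)$, an infinite set $D\subseteq\mathbb N$ and a separator $(f,g)$ such that for all $x<y$ in $D$: (1) for every $v\in E_{x,y}$ there is $\sigma\in\Theta$ with $v\preceq_\sigma f(x)$; and (2) for every $\sigma\in\Theta$ there is $v\in E_{x,y}$ with $v\preceq_\sigma f(x)$ and $v\not\preceq_{C\setminus\sigma}g(x)$.
   Context: $\bar T$ denotes the type in $\{B,S\}$ different from $T$. A $B$-function is a bounded function $\mathbb N\to\mathbb N$; an $S$-function is a function $f:\mathbb N\to\mathbb N$ with $\liminf_n f(n)=+\infty$. The order $\preceq$ is $\le$ if $T=S$ and $\ge$ if $T=B$. A separator is a pair $(f,g)$ where $f$ is a $\bar T$-function and $g$ is a $T$-function. For $v\in\mathbb N^C$, $\sigma\subseteq C$, $M\in\mathbb N$: $v\preceq_\sigma M$ means $v(\alpha)\preceq M$ for all $\alpha\in\sigma$, and $v\not\preceq_\sigma M$ means that $v(\alpha)\preceq M$ fails for every $\alpha\in\sigma$. -}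

module Defs where

open import Data.Nat using (ℕ; _≤_; _<_; _≥_)
open import Data.Fin using (Fin)
open import Data.Fin.Subset using (Subset; _∈_; _∉_)
open import Data.List.NonEmpty using (List⁺)
open import Data.Product using (Σ; ∃; _×_)
open import Relation.Nullary using (¬_)

data Ty : Set where
  B S : Ty

bar : Ty → Ty
bar B = S
bar S = B

IsBFun : (ℕ → ℕ) → Set
IsBFun f = ∃ λ M → ∀ n → f n ≤ M

IsSFun : (ℕ → ℕ) → Set
IsSFun f = ∀ M → ∃ λ N → ∀ n → N ≤ n → M ≤ f n

IsFun : Ty → (ℕ → ℕ) → Set
IsFun B f = IsBFun f
IsFun S f = IsSFun f

_≼⟨_⟩_ : ℕ → Ty → ℕ → Set
a ≼⟨ S ⟩ b = a ≤ b
a ≼⟨ B ⟩ b = a ≥ b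

IsSeparator : Ty → (ℕ → ℕ) → (ℕ → ℕ) → Set
IsSeparator T f g = IsFun (bar T) f × IsFun T g

-- C is the finite set Fin k; vectors in ℕ^C are functions Fin k → ℕ.
Vector : ℕ → Set
Vector k = Fin k → ℕ

LeOn : ∀ {k} → Ty → Vector k → Subset k → ℕ → Set
LeOn T v σ M = ∀ α → α ∈ σ → v α ≼⟨ T ⟩ M

NotLeOn : ∀ {k} → Ty → Vector k → Subset k → ℕ → Set
NotLeOn T v σ M = ∀ α → α ∈ σ → ¬ (v α ≼⟨ T ⟩ M)

Infinite : (ℕ → Set) → Set
Infinite D = ∀ n → ∃ λ m → n ≤ m × D m

-- Θ is built in k + 1 rounds, keeping an infinite D and a separator (f , g) such that every
-- σ ∈ Θ is witnessed on all pairs of D, and after j rounds every v ∈ E x y not yet covered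
-- by Θ has v α ≼ f x for at least j coordinates α. In a round, each τ ⊆ C colours the pair
-- x < y by the best value, over the candidates v ∈ E x y with v ≼_τ f x, of the extreme
-- coordinate of v outside τ (the largest minimum for S, the least maximum for B). Ramsey's
-- theorem for pairs, in the form "bounded or tending to infinity" and proved with excluded
-- middle, thins D so that each of these finitely many colourings is one or the other.
-- For S the divergent τ join Θ and their growth is diagonalised into g, while the bound of
-- the bounded ones is added to f; for B the bounded τ join Θ with the bound added to g,
-- while the divergent ones are diagonalised into f. Either way, an uncovered v whose set
-- τ = {α | v α ≼ f x} has not joined Θ gains a coordinate under the new f, so after k + 1
-- rounds everything is covered.

module Submission where

open import Defs
open import Level using (0ℓ)
open import Axiom.ExcludedMiddle using (ExcludedMiddle)
open import Function using (case_of_; id)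
open import Data.Empty using (⊥; ⊥-elim)
open import Data.Unit using (tt)
open import Data.Product using (Σ; ∃; ∃₂; _×_; _,_; proj₁; proj₂)
open import Data.Sum as Sum using (_⊎_; inj₁; inj₂)
open import Data.Maybe using (Maybe; just; nothing)
open import Data.Nat
open import Data.Nat.Properties
open import Data.Fin.Properties using (all?)
open import Data.Fin.Subset using (Subset; inside; outside; ∁; _⊂_; ∣_∣) renaming (_∈_ to _∈ₛ_)
open import Data.Fin.Subset.Properties using (_∈?_; x∈∁p⇒x∉p; p⊂q⇒∣p∣<∣q∣; ∣p∣≤n)
import Data.Vec as Vec
open import Data.Vec.Properties using (lookup∘tabulate; lookup⇒[]=; []=⇒lookup)
open import Data.List using (List; []; _∷_; _++_; map; filter; allFin)
open import Data.List.NonEmpty using (List⁺; toList)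
open import Data.List.Extrema.Nat using (min; max; min≤xs; xs≤max; argmin-sel; argmax-sel)
open import Data.List.Membership.Propositional using (_∈_)
open import Data.List.Membership.Propositional.Properties
  using (∈-map⁺; ∈-map⁻; ∈-filter⁺; ∈-filter⁻; ∈-++⁺ˡ; ∈-++⁺ʳ; ∈-++⁻; ∈-allFin)
import Data.List.Relation.Unary.All as All
open import Data.List.Relation.Unary.Any using (here; there)
open import Relation.Nullary using (¬_; Dec; yes; no; does)
open import Relation.Nullary.Decidable using (_→-dec_; dec-true)
open import Relation.Unary using (Pred; _⊆_; _∩_; U)
open import Relation.Binary.PropositionalEquality using (_≡_; refl; sym; trans; cong; subst)

Eventually : Pred ℕ 0ℓ → Set
Eventually P = ∃ λ N → ∀ x → N ≤ x → P x

eventually-∀∈ : ∀ {I : Set} {P : I → Pred ℕ 0ℓ} (Θ : List I) →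
                (∀ τ → τ ∈ Θ → Eventually (P τ)) →
                Eventually (λ x → ∀ τ → τ ∈ Θ → P τ x)
eventually-∀∈ [] ev = 0 , λ _ _ _ ()
eventually-∀∈ (σ ∷ Θ) ev with ev σ (here refl) | eventually-∀∈ Θ (λ τ τ∈ → ev τ (there τ∈))
... | N , Pσ | N′ , PΘ = N ⊔ N′ , λ where
  x N≤x .σ (here refl) → Pσ x (m⊔n≤o⇒m≤o N N′ N≤x)
  x N≤x τ (there τ∈) → PΘ x (m⊔n≤o⇒n≤o N N′ N≤x) τ τ∈

infinite-∩-eventually : ∀ {P Q : Pred ℕ 0ℓ} → Infinite P → Eventually Q → Infinite (P ∩ Q)
infinite-∩-eventually infP (N , Q) n with infP (n ⊔ N)
... | m , n⊔N≤m , Pm = m , m⊔n≤o⇒m≤o n N n⊔N≤m , Pm , Q m (m⊔n≤o⇒n≤o n N n⊔N≤m)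

infinite-mono : ∀ {P Q : Pred ℕ 0ℓ} → P ⊆ Q → Infinite P → Infinite Q
infinite-mono P⊆Q infP n with infP n
... | m , n≤m , Pm = m , n≤m , P⊆Q Pm

eventually-∉-≤ : ∀ {X : Pred ℕ 0ℓ} (c : ℕ → ℕ) →
                 (∀ m → Eventually (λ y → ¬ (X y × c y ≡ m))) →
                 ∀ i → Eventually (λ y → ¬ (X y × c y ≤ i))
eventually-∉-≤ c ev zero with ev 0
... | N , ∉ = N , λ y N≤y (Xy , cy≤0) → ∉ y N≤y (Xy , n≤0⇒n≡0 cy≤0)
eventually-∉-≤ c ev (suc i) with ev (suc i) | eventually-∉-≤ c ev i
... | N , ∉ | N′ , ∉′ = N ⊔ N′ , λ where
  y N≤y (Xy , cy≤1+i) → case m≤n⇒m<n∨m≡n cy≤1+i of λ where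
    (inj₁ cy<1+i) → ∉′ y (m⊔n≤o⇒n≤o N N′ N≤y) (Xy , ≤-pred cy<1+i)
    (inj₂ cy≡1+i) → ∉ y (m⊔n≤o⇒m≤o N N′ N≤y) (Xy , cy≡1+i)

-- The diagonal h x is the largest M ≤ x whose threshold x has passed.
module Diagonal {Q : ℕ → Pred ℕ 0ℓ} (ev : ∀ M → Eventually (Q M)) where

  threshold : ℕ → ℕ
  threshold M = proj₁ (ev M)

  largestPassed : ℕ → ℕ → ℕ
  largestPassed x zero = zero
  largestPassed x (suc M) with threshold (suc M) ≤? x
  ... | yes _ = suc M
  ... | no _ = largestPassed x M

  largestPassed-passed : ∀ x M → threshold 0 ≤ x → threshold (largestPassed x M) ≤ x
  largestPassed-passed x zero N₀≤x = N₀≤x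
  largestPassed-passed x (suc M) N₀≤x with threshold (suc M) ≤? x
  ... | yes N≤x = N≤x
  ... | no _ = largestPassed-passed x M N₀≤x

  largestPassed-largest : ∀ x M M′ → M′ ≤ M → threshold M′ ≤ x → M′ ≤ largestPassed x M
  largestPassed-largest x zero M′ M′≤0 _ = M′≤0
  largestPassed-largest x (suc M) M′ M′≤1+M N≤x with threshold (suc M) ≤? x
  ... | yes _ = M′≤1+M
  ... | no N≰x with m≤n⇒m<n∨m≡n M′≤1+M
  ...   | inj₁ M′<1+M = largestPassed-largest x M M′ (≤-pred M′<1+M) N≤x
  ...   | inj₂ refl = ⊥-elim (N≰x N≤x)

diagonalise : ∀ {Q : ℕ → Pred ℕ 0ℓ} → (∀ M → Eventually (Q M)) →
              ∃ λ h → IsSFun h × Eventually (λ x → Q (h x) x)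
diagonalise ev =
  h , h-diverges , threshold 0 , λ x N₀≤x → proj₂ (ev (h x)) x (largestPassed-passed x x N₀≤x)
  where
  open Diagonal ev
  h : ℕ → ℕ
  h x = largestPassed x x
  h-diverges : IsSFun h
  h-diverges M = M ⊔ threshold M , λ x M⊔N≤x →
    largestPassed-largest x x M (m⊔n≤o⇒m≤o M _ M⊔N≤x) (m⊔n≤o⇒n≤o M _ M⊔N≤x)

-- Ramsey's theorem for ℕ-valued colourings of pairs

ForPairs : Pred ℕ 0ℓ → (ℕ → ℕ → Set) → Set
ForPairs D P = ∀ x y → x < y → D x → D y → P x y

Bounded : (ℕ → ℕ → ℕ) → Pred ℕ 0ℓ → ℕ → Set
Bounded c D b = ForPairs D λ x y → c x y ≤ b

Divergent : (ℕ → ℕ → ℕ) → Pred ℕ 0ℓ → Set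
Divergent c D = ∀ M → Eventually λ x → ∀ y → x < y → D x → D y → M < c x y

bounded-weaken : ∀ {c D D′ b b′} → D′ ⊆ D → b ≤ b′ → Bounded c D b → Bounded c D′ b′
bounded-weaken D′⊆D b≤b′ bd x y x<y Dx Dy = ≤-trans (bd x y x<y (D′⊆D Dx) (D′⊆D Dy)) b≤b′

divergent-⊆ : ∀ {c D D′} → D′ ⊆ D → Divergent c D → Divergent c D′
divergent-⊆ D′⊆D dv M with dv M
... | N , above = N , λ x N≤x y x<y Dx Dy → above x N≤x y x<y (D′⊆D Dx) (D′⊆D Dy)

divergent-diagonal : ∀ {I : Set} {c : I → ℕ → ℕ → ℕ} {D : Pred ℕ 0ℓ} (Θ : List I) →
  (∀ τ → τ ∈ Θ → Divergent (c τ) D) →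
  ∃ λ h → IsSFun h × Eventually λ x → ∀ τ → τ ∈ Θ → ∀ y → x < y → D x → D y → h x < c τ x y
divergent-diagonal Θ dv = diagonalise λ M → eventually-∀∈ Θ λ τ τ∈ → dv τ τ∈ M

record Partition {I : Set} (c : I → ℕ → ℕ → ℕ) (Ts : List I) (A : Pred ℕ 0ℓ) : Set₁ where
  field
    D : Pred ℕ 0ℓ
    D⊆A : D ⊆ A
    infinite : Infinite D
    bound : ℕ
    bounded divergent : List I
    bounded-bounded : ∀ τ → τ ∈ bounded → Bounded (c τ) D bound
    divergent-divergent : ∀ τ → τ ∈ divergent → Divergent (c τ) D
    complete : ∀ τ → τ ∈ Ts → τ ∈ bounded ⊎ τ ∈ divergent

module _ (em : ExcludedMiddle 0ℓ) where

  ¬infinite⇒eventually-∉ : ∀ {X : Pred ℕ 0ℓ} → ¬ Infinite X → Eventually (λ y → ¬ X y)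
  ¬infinite⇒eventually-∉ {X} ¬inf with em {Eventually (λ y → ¬ X y)}
  ... | yes ev = ev
  ... | no ¬ev = ⊥-elim (¬inf above)
    where
    above : Infinite X
    above n with em {∃ λ m → n ≤ m × X m}
    ... | yes ∃m = ∃m
    ... | no ¬∃m = ⊥-elim (¬ev (n , λ m n≤m Xm → ¬∃m (m , n≤m , Xm)))

  module Ramsey (c : ℕ → ℕ → ℕ) {A : Pred ℕ 0ℓ} (infA : Infinite A) where

    -- Beyond step i, c x is constant (just m) or exceeds i (nothing).
    Settled : ℕ → ℕ → Maybe ℕ → Pred ℕ 0ℓ
    Settled i x (just m) y = c x y ≡ m
    Settled i x nothing y = i < c x y

    InfiniteSet : Set₁
    InfiniteSet = Σ (Pred ℕ 0ℓ) Infinite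

    element : InfiniteSet → ℕ
    element (_ , inf) = proj₁ (inf 0)

    element∈ : (s : InfiniteSet) → proj₁ s (element s)
    element∈ (_ , inf) = proj₂ (proj₂ (inf 0))

    Rest : ℕ → InfiniteSet → Maybe ℕ → Pred ℕ 0ℓ
    Rest i s L = (proj₁ s ∩ (element s <_)) ∩ Settled i (element s) L

    settle : ∀ i s → Σ (Maybe ℕ) λ L → Infinite (Rest i s L)
    settle i s@(X , infX) with em {∃ λ m → Infinite (Rest i s (just m))}
    ... | yes (m , inf) = just m , inf
    ... | no ¬∃ = nothing , infinite-mono large
        (infinite-∩-eventually (infinite-∩-eventually infX (suc x , λ _ x<y → x<y))
          (eventually-∉-≤ (c x) (λ m → ¬infinite⇒eventually-∉ (λ inf → ¬∃ (m , inf))) i))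
      where
      x = element s
      large : ∀ {y} → (X y × x < y) × ¬ ((X y × x < y) × c x y ≤ i) → Rest i s nothing y
      large (Xy,x<y , ¬small) = Xy,x<y , ≰⇒> (λ c≤i → ¬small (Xy,x<y , c≤i))

    stage : ℕ → InfiniteSet
    stage zero = A , infA
    stage (suc i) = Rest i (stage i) (proj₁ (settle i (stage i))) , proj₂ (settle i (stage i))

    label : ℕ → Maybe ℕ
    label i = proj₁ (settle i (stage i))

    point : ℕ → ℕ
    point i = element (stage i)

    stage-anti : ∀ {i j} → i ≤ j → proj₁ (stage j) ⊆ proj₁ (stage i)
    stage-anti {j = zero} z≤n y∈ = y∈
    stage-anti {i} {suc j} i≤1+j y∈ with m≤n⇒m<n∨m≡n i≤1+j
    ... | inj₁ i<1+j = stage-anti (≤-pred i<1+j) (proj₁ (proj₁ y∈))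
    ... | inj₂ refl = y∈

    point-suc : ∀ i → point i < point (suc i)
    point-suc i = proj₂ (proj₁ (element∈ (stage (suc i))))

    point-mono-< : ∀ {i j} → i < j → point i < point j
    point-mono-< {i} {suc j} i<1+j with m≤n⇒m<n∨m≡n (≤-pred i<1+j)
    ... | inj₁ i<j = <-trans (point-mono-< i<j) (point-suc j)
    ... | inj₂ refl = point-suc i

    point-mono-≤ : ∀ {i j} → i ≤ j → point i ≤ point j
    point-mono-≤ i≤j with m≤n⇒m<n∨m≡n i≤j
    ... | inj₁ i<j = <⇒≤ (point-mono-< i<j)
    ... | inj₂ refl = ≤-refl

    point-cancel-< : ∀ {i j} → point i < point j → i < j
    point-cancel-< pi<pj = ≰⇒> λ j≤i → <⇒≱ pi<pj (point-mono-≤ j≤i)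

    point-cancel-≤ : ∀ {i j} → point i ≤ point j → i ≤ j
    point-cancel-≤ pi≤pj = ≮⇒≥ λ j<i → <⇒≱ (point-mono-< j<i) pi≤pj

    i≤point : ∀ i → i ≤ point i
    i≤point zero = z≤n
    i≤point (suc i) = ≤-<-trans (i≤point i) (point-suc i)

    point∈A : ∀ i → A (point i)
    point∈A i = stage-anti {j = i} z≤n (element∈ (stage i))

    point-settled : ∀ i j → point i < point j → Settled i (point i) (label i) (point j)
    point-settled i j pi<pj = proj₂ (stage-anti {j = j} (point-cancel-< pi<pj) (element∈ (stage j)))

    Image : Pred ℕ 0ℓ → Pred ℕ 0ℓ
    Image I x = ∃ λ i → I i × x ≡ point i

    image-infinite : ∀ {I} → Infinite I → Infinite (Image I)
    image-infinite infI n with infI n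
    ... | i , n≤i , Ii = point i , ≤-trans n≤i (i≤point i) , i , Ii , refl

    image⊆A : ∀ {I} → Image I ⊆ A
    image⊆A (i , _ , refl) = point∈A i

    BoundedLabel : ℕ → Maybe ℕ → Set
    BoundedLabel M (just m) = m ≤ M
    BoundedLabel M nothing = ⊥

    settled-≤ : ∀ {i x y M} L → BoundedLabel M L → Settled i x L y → c x y ≤ M
    settled-≤ (just m) m≤M c≡m = ≤-trans (≤-reflexive c≡m) m≤M

    settled-> : ∀ {i x y M} L → ¬ BoundedLabel M L → M ≤ i → Settled i x L y → M < c x y
    settled-> (just m) m≰M _ c≡m = <-≤-trans (≰⇒> m≰M) (≤-reflexive (sym c≡m))
    settled-> nothing _ M≤i i<c = ≤-<-trans M≤i i<c

    -- Either infinitely many labels are at most some M, or for every M the labels eventually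
    -- exceed it (a label nothing at step i ≥ M exceeds it too).
    dichotomy : Σ (Pred ℕ 0ℓ) λ D → D ⊆ A × Infinite D × ∃ λ b → Bounded c D b ⊎ Divergent c D
    dichotomy with em {∃ λ M → Infinite (λ i → BoundedLabel M (label i))}
    ... | yes (M , inf) = Image _ , image⊆A , image-infinite inf , M , inj₁ bounded
      where
      bounded : Bounded c (Image λ i → BoundedLabel M (label i)) M
      bounded _ _ x<y (i , bi , refl) (j , _ , refl) = settled-≤ (label i) bi (point-settled i j x<y)
    ... | no ¬∃ = Image U , image⊆A , image-infinite (λ n → n , ≤-refl , tt) , 0 , inj₂ divergent
      where
      divergent : Divergent c (Image U)
      divergent M with ¬infinite⇒eventually-∉ (λ inf → ¬∃ (M , inf))
      ... | n , unbounded = point (n ⊔ M) , λ where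
        _ N≤x _ x<y (i , _ , refl) (j , _ , refl) →
          let n⊔M≤i = point-cancel-≤ {j = i} N≤x in
          settled-> (label i) (unbounded i (m⊔n≤o⇒m≤o n M n⊔M≤i)) (m⊔n≤o⇒n≤o n M n⊔M≤i)
                    (point-settled i j x<y)

  ramsey-dichotomy : (c : ℕ → ℕ → ℕ) {A : Pred ℕ 0ℓ} → Infinite A →
                     Σ (Pred ℕ 0ℓ) λ D → D ⊆ A × Infinite D × ∃ λ b → Bounded c D b ⊎ Divergent c D
  ramsey-dichotomy c infA = Ramsey.dichotomy c infA

  ramsey-classification : ∀ {I : Set} (c : I → ℕ → ℕ → ℕ) (Ts : List I) {A : Pred ℕ 0ℓ} → Infinite A →
    Σ (Pred ℕ 0ℓ) λ D → D ⊆ A × Infinite D ×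
      ∃ λ b → ∀ τ → τ ∈ Ts → Bounded (c τ) D b ⊎ Divergent (c τ) D
  ramsey-classification c [] infA = _ , (λ Ax → Ax) , infA , 0 , λ _ ()
  ramsey-classification c (σ ∷ Ts) infA with ramsey-classification c Ts infA
  ... | D₁ , D₁⊆A , infD₁ , b₁ , classes with ramsey-dichotomy (c σ) infD₁
  ... | D , D⊆D₁ , infD , b₂ , σ-class = D , (λ Dx → D₁⊆A (D⊆D₁ Dx)) , infD , b₁ ⊔ b₂ , λ where
    .σ (here refl) → Sum.map (bounded-weaken id (m≤n⊔m b₁ b₂)) id σ-class
    τ (there τ∈) → Sum.map (bounded-weaken D⊆D₁ (m≤m⊔n b₁ b₂)) (divergent-⊆ D⊆D₁) (classes τ τ∈)

  ramsey-partition : ∀ {I : Set} (c : I → ℕ → ℕ → ℕ) (Ts : List I) {A : Pred ℕ 0ℓ} →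
                     Infinite A → Partition c Ts A
  ramsey-partition c Ts infA with ramsey-classification c Ts infA
  ... | D , D⊆A , infD , b , classes = record
    { D = D ; D⊆A = D⊆A ; infinite = infD ; bound = b
    ; bounded = filter bounded? Ts ; divergent = filter divergent? Ts
    ; bounded-bounded = λ τ τ∈ → proj₂ (∈-filter⁻ bounded? {xs = Ts} τ∈)
    ; divergent-divergent = λ τ τ∈ → proj₂ (∈-filter⁻ divergent? {xs = Ts} τ∈)
    ; complete = λ τ τ∈ → Sum.map (∈-filter⁺ bounded? τ∈) (∈-filter⁺ divergent? τ∈) (classes τ τ∈)
    }
    where
    bounded? : ∀ τ → Dec (Bounded (c τ) D b)
    bounded? τ = em
    divergent? : ∀ τ → Dec (Divergent (c τ) D)
    divergent? τ = em

min≤∈ : ∀ {d x xs} → x ∈ xs → min d xs ≤ x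
min≤∈ {d} {xs = xs} = All.lookup (min≤xs d xs)

∈≤max : ∀ {d x xs} → x ∈ xs → x ≤ max d xs
∈≤max {d} {xs = xs} = All.lookup (xs≤max d xs)

min<⇒∈ : ∀ {d} xs → min d xs < d → min d xs ∈ xs
min<⇒∈ {d} xs min<d with argmin-sel id d xs
... | inj₁ min≡d = ⊥-elim (<-irrefl min≡d min<d)
... | inj₂ min∈xs = min∈xs

>max⇒∈ : ∀ {d} xs → d < max d xs → max d xs ∈ xs
>max⇒∈ {d} xs d<max with argmax-sel id d xs
... | inj₁ max≡d = ⊥-elim (<-irrefl (sym max≡d) d<max)
... | inj₂ max∈xs = max∈xs

values : ∀ {k} → Vector k → Subset k → List ℕ
values v σ = map v (filter (_∈? σ) (allFin _))

∈-values⁺ : ∀ {k} {v : Vector k} {σ α} → α ∈ₛ σ → v α ∈ values v σ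
∈-values⁺ {v = v} {σ} {α} α∈σ = ∈-map⁺ v (∈-filter⁺ (_∈? σ) (∈-allFin α) α∈σ)

∈-values⁻ : ∀ {k} {v : Vector k} {σ m} → m ∈ values v σ → ∃ λ α → α ∈ₛ σ × m ≡ v α
∈-values⁻ {σ = σ} m∈ with ∈-map⁻ _ m∈
... | α , α∈ , m≡vα = α , proj₂ (∈-filter⁻ (_∈? σ) {xs = allFin _} α∈) , m≡vα

min-values≤ : ∀ {k} {v : Vector k} {σ d b} → min d (values v σ) ≤ b → b < d → ∃ λ α → α ∈ₛ σ × v α ≤ b
min-values≤ {v = v} {σ} min≤b b<d with ∈-values⁻ (min<⇒∈ (values v σ) (≤-<-trans min≤b b<d))
... | α , α∈ , min≡vα = α , α∈ , ≤-trans (≤-reflexive (sym min≡vα)) min≤b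

<max-values : ∀ {k} {v : Vector k} {σ m} → m < max 0 (values v σ) → ∃ λ α → α ∈ₛ σ × m < v α
<max-values {v = v} {σ} m<max with ∈-values⁻ (>max⇒∈ (values v σ) (≤-<-trans z≤n m<max))
... | α , α∈ , max≡vα = α , α∈ , <-≤-trans m<max (≤-reflexive max≡vα)

allSubsets : ∀ k → List (Subset k)
allSubsets zero = Vec.[] ∷ []
allSubsets (suc k) = map (inside Vec.∷_) (allSubsets k) ++ map (outside Vec.∷_) (allSubsets k)

∈-allSubsets : ∀ {k} (τ : Subset k) → τ ∈ allSubsets k
∈-allSubsets Vec.[] = here refl
∈-allSubsets (inside Vec.∷ τ) = ∈-++⁺ˡ (∈-map⁺ (inside Vec.∷_) (∈-allSubsets τ))
∈-allSubsets {suc k} (outside Vec.∷ τ) =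
  ∈-++⁺ʳ (map (inside Vec.∷_) (allSubsets k)) (∈-map⁺ (outside Vec.∷_) (∈-allSubsets τ))

≼-dec : ∀ T a b → Dec (a ≼⟨ T ⟩ b)
≼-dec S a b = a ≤? b
≼-dec B a b = b ≤? a

≼-trans : ∀ T {a b c} → a ≼⟨ T ⟩ b → b ≼⟨ T ⟩ c → a ≼⟨ T ⟩ c
≼-trans S a≤b b≤c = ≤-trans a≤b b≤c
≼-trans B a≥b b≥c = ≤-trans b≥c a≥b

module _ (T : Ty) {k : ℕ} where

  LeOn-dec : ∀ (v : Vector k) σ M → Dec (LeOn T v σ M)
  LeOn-dec v σ M = all? λ α → (α ∈? σ) →-dec ≼-dec T (v α) M

  LeOn-≼ : ∀ {v : Vector k} {σ M M′} → M ≼⟨ T ⟩ M′ → LeOn T v σ M → LeOn T v σ M′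
  LeOn-≼ M≼M′ le α α∈σ = ≼-trans T (le α α∈σ) M≼M′

  NotLeOn-≼ : ∀ {v : Vector k} {σ M M′} → M′ ≼⟨ T ⟩ M → NotLeOn T v σ M → NotLeOn T v σ M′
  NotLeOn-≼ M′≼M nle α α∈σ vα≼M′ = nle α α∈σ (≼-trans T vα≼M′ M′≼M)

  below : Vector k → ℕ → Subset k
  below v M = Vec.tabulate λ α → does (≼-dec T (v α) M)

  ∈-below⁺ : ∀ {v : Vector k} {M α} → v α ≼⟨ T ⟩ M → α ∈ₛ below v M
  ∈-below⁺ {v} {M} {α} vα≼M =
    lookup⇒[]= α _ (trans (lookup∘tabulate _ α) (dec-true (≼-dec T (v α) M) vα≼M))

  ∈-below⁻ : ∀ {v : Vector k} {M α} → α ∈ₛ below v M → v α ≼⟨ T ⟩ M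
  ∈-below⁻ {v} {M} {α} α∈ with ≼-dec T (v α) M | trans (sym (lookup∘tabulate _ α)) ([]=⇒lookup α∈)
  ... | yes vα≼M | _ = vα≼M
  ... | no _ | ()

  below-⊂ : ∀ (v : Vector k) {M M′} α → M ≼⟨ T ⟩ M′ → α ∈ₛ ∁ (below v M) → v α ≼⟨ T ⟩ M′ →
            below v M ⊂ below v M′
  below-⊂ v α M≼M′ α∉ vα≼M′ =
    (λ β∈ → ∈-below⁺ (≼-trans T (∈-below⁻ β∈) M≼M′)) , α , ∈-below⁺ vα≼M′ , x∈∁p⇒x∉p α∉

-- The rounds of the construction

IsBFun-⊔ : ∀ {f} b → IsBFun f → IsBFun (λ x → f x ⊔ b)
IsBFun-⊔ b (M , f≤M) = M ⊔ b , λ n → ⊔-mono-≤ (f≤M n) ≤-refl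

IsSFun-⊓ : ∀ {f g} → IsSFun f → IsSFun g → IsSFun (λ x → f x ⊓ g x)
IsSFun-⊓ f-diverges g-diverges M with f-diverges M | g-diverges M
... | N , M≤f | N′ , M≤g = N ⊔ N′ , λ n N⊔N′≤n →
  ⊓-glb (M≤f n (m⊔n≤o⇒m≤o N N′ N⊔N′≤n)) (M≤g n (m⊔n≤o⇒n≤o N N′ N⊔N′≤n))

separator-exists : ∀ T → ∃₂ (IsSeparator T)
separator-exists S = (λ _ → 0) , id , (0 , λ _ → z≤n) , λ M → M , λ _ M≤n → M≤n
separator-exists B = id , (λ _ → 0) , (λ M → M , λ _ M≤n → M≤n) , (0 , λ _ → z≤n)

module Stages (T : Ty) {k : ℕ} (E : ℕ → ℕ → List (Vector k)) where

  Witnessed : Pred ℕ 0ℓ → (ℕ → ℕ) → (ℕ → ℕ) → Subset k → Set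
  Witnessed D f g σ = ForPairs D λ x y →
    ∃ λ w → w ∈ E x y × LeOn T w σ (f x) × NotLeOn T w (∁ σ) (g x)

  witnessed-weaken : ∀ {D D′ f f′ g g′ σ} → D′ ⊆ D → (∀ x → f x ≼⟨ T ⟩ f′ x) → (∀ x → g′ x ≼⟨ T ⟩ g x) →
                     Witnessed D f g σ → Witnessed D′ f′ g′ σ
  witnessed-weaken D′⊆D f≼f′ g′≼g wit x y x<y D′x D′y with wit x y x<y (D′⊆D D′x) (D′⊆D D′y)
  ... | w , w∈ , le , nle = w , w∈ , LeOn-≼ T (f≼f′ x) le , NotLeOn-≼ T (g′≼g x) nle

  record Stage (j : ℕ) : Set₁ where
    field
      D : Pred ℕ 0ℓ
      infinite : Infinite D
      f g : ℕ → ℕ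
      separator : IsSeparator T f g
      Θ : List (Subset k)
      witnessed : ∀ σ → σ ∈ Θ → Witnessed D f g σ
      covered : ForPairs D λ x y → ∀ v → v ∈ E x y →
                (∃ λ σ → σ ∈ Θ × LeOn T v σ (f x)) ⊎ j ≤ ∣ below T v (f x) ∣

  record Refinement (D : Pred ℕ 0ℓ) (f g : ℕ → ℕ) : Set₁ where
    field
      D′ : Pred ℕ 0ℓ
      D′⊆D : D′ ⊆ D
      D′-infinite : Infinite D′
      f′ g′ : ℕ → ℕ
      separator′ : IsSeparator T f′ g′
      f≼f′ : ∀ x → f x ≼⟨ T ⟩ f′ x
      g′≼g : ∀ x → g′ x ≼⟨ T ⟩ g x
      Θ′ : List (Subset k)
      Θ′-witnessed : ∀ σ → σ ∈ Θ′ → Witnessed D′ f′ g′ σ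
      progress : ForPairs D′ λ x y → ∀ v → v ∈ E x y →
                 below T v (f x) ∈ Θ′ ⊎ below T v (f x) ⊂ below T v (f′ x)

  refine : ∀ {j} (st : Stage j) → Refinement (Stage.D st) (Stage.f st) (Stage.g st) → Stage (suc j)
  refine st r = record
    { D = D′ ; infinite = D′-infinite ; f = f′ ; g = g′ ; separator = separator′ ; Θ = Θ ++ Θ′
    ; witnessed = witnessed′ ; covered = covered′ }
    where
    open Stage st
    open Refinement r

    witnessed′ : ∀ σ → σ ∈ Θ ++ Θ′ → Witnessed D′ f′ g′ σ
    witnessed′ σ σ∈ with ∈-++⁻ Θ σ∈
    ... | inj₁ σ∈Θ = witnessed-weaken D′⊆D f≼f′ g′≼g (witnessed σ σ∈Θ)
    ... | inj₂ σ∈Θ′ = Θ′-witnessed σ σ∈Θ′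

    covered′ : ForPairs D′ λ x y → ∀ v → v ∈ E x y →
               (∃ λ σ → σ ∈ Θ ++ Θ′ × LeOn T v σ (f′ x)) ⊎ suc _ ≤ ∣ below T v (f′ x) ∣
    covered′ x y x<y D′x D′y v v∈
      with covered x y x<y (D′⊆D D′x) (D′⊆D D′y) v v∈ | progress x y x<y D′x D′y v v∈
    ... | inj₁ (σ , σ∈ , le) | _ = inj₁ (σ , ∈-++⁺ˡ σ∈ , LeOn-≼ T (f≼f′ x) le)
    ... | inj₂ _ | inj₁ τ∈ = inj₁ (_ , ∈-++⁺ʳ Θ τ∈ , LeOn-≼ T (f≼f′ x) (λ _ → ∈-below⁻ T))
    ... | inj₂ j≤ | inj₂ τ⊂ = inj₂ (≤-<-trans j≤ (p⊂q⇒∣p∣<∣q∣ τ⊂))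

  initial : ∃₂ (IsSeparator T) → Stage 0
  initial (f , g , sep) = record
    { D = U ; infinite = λ n → n , ≤-refl , tt ; f = f ; g = g ; separator = sep ; Θ = []
    ; witnessed = λ _ () ; covered = λ _ _ _ _ _ _ _ → inj₂ z≤n }

  iterate : (∀ {D f g} → Infinite D → IsSeparator T f g → Refinement D f g) →
            ∃₂ (IsSeparator T) → ∀ j → Stage j
  iterate refinement sep zero = initial sep
  iterate refinement sep (suc j) = refine st (refinement (Stage.infinite st) (Stage.separator st))
    where st = iterate refinement sep j

module RefinementS (em : ExcludedMiddle 0ℓ) {k : ℕ} (E : ℕ → ℕ → List (Vector k)) where
  open Stages S E

  module _ (f : ℕ → ℕ) where

    candidate? : ∀ τ x (w : Vector k) → Dec (LeOn S w τ (f x))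
    candidate? τ x w = LeOn-dec S w τ (f x)

    candidates : Subset k → ℕ → ℕ → List (Vector k)
    candidates τ x y = filter (candidate? τ x) (E x y)

    -- min y is y when τ is all of C; refinement keeps only y above the bound, so a bounded
    -- colour is attained by an actual coordinate outside τ.
    colour : Subset k → ℕ → ℕ → ℕ
    colour τ x y = max 0 (map (λ w → min y (values w (∁ τ))) (candidates τ x y))

    colour-large : ∀ {τ x y m} → m < colour τ x y →
                   ∃ λ w → w ∈ E x y × LeOn S w τ (f x) × (∀ α → α ∈ₛ ∁ τ → m < w α)
    colour-large {τ} {x} {y} m<c with ∈-map⁻ _ (>max⇒∈ _ (≤-<-trans z≤n m<c))
    ... | w , w∈ , c≡ with ∈-filter⁻ (candidate? τ x) {xs = E x y} w∈
    ...   | w∈E , le =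
      w , w∈E , le , λ α α∈ → <-≤-trans m<c (≤-trans (≤-reflexive c≡) (min≤∈ (∈-values⁺ α∈)))

    candidate≤colour : ∀ {τ x y v} → v ∈ E x y → LeOn S v τ (f x) →
                       min y (values v (∁ τ)) ≤ colour τ x y
    candidate≤colour {τ} {x} v∈ le = ∈≤max (∈-map⁺ _ (∈-filter⁺ (candidate? τ x) v∈ le))

    colour-small : ∀ {τ x y v b} → v ∈ E x y → LeOn S v τ (f x) → colour τ x y ≤ b → b < y →
                   ∃ λ α → α ∈ₛ ∁ τ × v α ≤ b
    colour-small v∈ le c≤b = min-values≤ (≤-trans (candidate≤colour v∈ le) c≤b)

  module _ {D : Pred ℕ 0ℓ} {f g : ℕ → ℕ} (infD : Infinite D) (sep : IsSeparator S f g) where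
    open Partition (ramsey-partition em (colour f) (allSubsets k) infD)
      renaming (D to D₁; D⊆A to D₁⊆D; infinite to D₁-infinite)

    refinement : Refinement D f g
    refinement with divergent-diagonal divergent divergent-divergent
    ... | h , h-diverges , K , h<colour = record
      { D′ = D′ ; D′⊆D = λ (D₁x , _) → D₁⊆D D₁x
      ; D′-infinite = infinite-∩-eventually D₁-infinite (_ , λ _ N≤x → N≤x)
      ; f′ = f′ ; g′ = g′
      ; separator′ = IsBFun-⊔ bound (proj₁ sep) , IsSFun-⊓ (proj₂ sep) h-diverges
      ; f≼f′ = λ x → m≤m⊔n (f x) bound ; g′≼g = λ x → m⊓n≤m (g x) (h x)
      ; Θ′ = divergent ; Θ′-witnessed = witnessed′ ; progress = progress′ }
      where
      D′ : Pred ℕ 0ℓ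
      D′ = D₁ ∩ (K ⊔ suc bound ≤_)
      f′ g′ : ℕ → ℕ
      f′ x = f x ⊔ bound
      g′ x = g x ⊓ h x

      witnessed′ : ∀ σ → σ ∈ divergent → Witnessed D′ f′ g′ σ
      witnessed′ σ σ∈ x y x<y (D₁x , N≤x) (D₁y , _)
        with colour-large f (h<colour x (m⊔n≤o⇒m≤o K _ N≤x) σ σ∈ y x<y D₁x D₁y)
      ... | w , w∈ , le , large = w , w∈ , LeOn-≼ S (m≤m⊔n (f x) bound) le ,
        λ α α∈ wα≤g′ → <⇒≱ (large α α∈) (≤-trans wα≤g′ (m⊓n≤n (g x) (h x)))

      progress′ : ForPairs D′ λ x y → ∀ v → v ∈ E x y →
                  below S v (f x) ∈ divergent ⊎ below S v (f x) ⊂ below S v (f′ x)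
      progress′ x y x<y (D₁x , _) (D₁y , N≤y) v v∈ with complete (below S v (f x)) (∈-allSubsets _)
      ... | inj₂ τ∈ = inj₁ τ∈
      ... | inj₁ τ∈ with colour-small f v∈ (λ _ → ∈-below⁻ S {v = v})
                           (bounded-bounded _ τ∈ x y x<y D₁x D₁y) (m⊔n≤o⇒n≤o K _ N≤y)
      ...   | α , α∉ , vα≤b =
        inj₂ (below-⊂ S v α (m≤m⊔n (f x) bound) α∉ (≤-trans vα≤b (m≤n⊔m (f x) bound)))

module RefinementB (em : ExcludedMiddle 0ℓ) {k : ℕ} (E : ℕ → ℕ → List (Vector k)) where
  open Stages B E

  module _ (f : ℕ → ℕ) where

    candidate? : ∀ τ x (w : Vector k) → Dec (LeOn B w τ (f x))
    candidate? τ x w = LeOn-dec B w τ (f x)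

    candidates : Subset k → ℕ → ℕ → List (Vector k)
    candidates τ x y = filter (candidate? τ x) (E x y)

    -- min y is y when there is no candidate; as for S, only y above the bound are kept, so a
    -- bounded colour is attained by a candidate.
    colour : Subset k → ℕ → ℕ → ℕ
    colour τ x y = min y (map (λ w → max 0 (values w (∁ τ))) (candidates τ x y))

    colour≤candidate : ∀ {τ x y v} → v ∈ E x y → LeOn B v τ (f x) →
                       colour τ x y ≤ max 0 (values v (∁ τ))
    colour≤candidate {τ} {x} v∈ le = min≤∈ (∈-map⁺ _ (∈-filter⁺ (candidate? τ x) v∈ le))

    colour-small : ∀ {τ x y b} → colour τ x y ≤ b → b < y →
                   ∃ λ w → w ∈ E x y × LeOn B w τ (f x) × (∀ α → α ∈ₛ ∁ τ → w α ≤ b)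
    colour-small {τ} {x} {y} c≤b b<y with ∈-map⁻ _ (min<⇒∈ _ (≤-<-trans c≤b b<y))
    ... | w , w∈ , c≡ with ∈-filter⁻ (candidate? τ x) {xs = E x y} w∈
    ...   | w∈E , le =
      w , w∈E , le , λ α α∈ → ≤-trans (∈≤max (∈-values⁺ α∈)) (≤-trans (≤-reflexive (sym c≡)) c≤b)

    colour-large : ∀ {τ x y v m} → v ∈ E x y → LeOn B v τ (f x) → m < colour τ x y →
                   ∃ λ α → α ∈ₛ ∁ τ × m < v α
    colour-large v∈ le m<c = <max-values (<-≤-trans m<c (colour≤candidate v∈ le))

  module _ {D : Pred ℕ 0ℓ} {f g : ℕ → ℕ} (infD : Infinite D) (sep : IsSeparator B f g) where
    open Partition (ramsey-partition em (colour f) (allSubsets k) infD)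
      renaming (D to D₁; D⊆A to D₁⊆D; infinite to D₁-infinite)

    refinement : Refinement D f g
    refinement with divergent-diagonal divergent divergent-divergent
    ... | h , h-diverges , K , h<colour = record
      { D′ = D′ ; D′⊆D = λ (D₁x , _) → D₁⊆D D₁x
      ; D′-infinite = infinite-∩-eventually D₁-infinite (_ , λ _ N≤x → N≤x)
      ; f′ = f′ ; g′ = g′
      ; separator′ = IsSFun-⊓ (proj₁ sep) h-diverges , IsBFun-⊔ (suc bound) (proj₂ sep)
      ; f≼f′ = λ x → m⊓n≤m (f x) (h x) ; g′≼g = λ x → m≤m⊔n (g x) (suc bound)
      ; Θ′ = bounded ; Θ′-witnessed = witnessed′ ; progress = progress′ }
      where
      D′ : Pred ℕ 0ℓ
      D′ = D₁ ∩ (K ⊔ suc bound ≤_)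
      f′ g′ : ℕ → ℕ
      f′ x = f x ⊓ h x
      g′ x = g x ⊔ suc bound

      witnessed′ : ∀ σ → σ ∈ bounded → Witnessed D′ f′ g′ σ
      witnessed′ σ σ∈ x y x<y (D₁x , _) (D₁y , N≤y)
        with colour-small f (bounded-bounded σ σ∈ x y x<y D₁x D₁y) (m⊔n≤o⇒n≤o K _ N≤y)
      ... | w , w∈ , le , small = w , w∈ , LeOn-≼ B (m⊓n≤m (f x) (h x)) le ,
        λ α α∈ g′≤wα → <⇒≱ (s≤s (small α α∈)) (≤-trans (m≤n⊔m (g x) (suc bound)) g′≤wα)

      progress′ : ForPairs D′ λ x y → ∀ v → v ∈ E x y →
                  below B v (f x) ∈ bounded ⊎ below B v (f x) ⊂ below B v (f′ x)
      progress′ x y x<y (D₁x , N≤x) (D₁y , _) v v∈ with complete (below B v (f x)) (∈-allSubsets _)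
      ... | inj₁ τ∈ = inj₁ τ∈
      ... | inj₂ τ∈ with colour-large f v∈ (λ _ → ∈-below⁻ B {v = v})
                           (h<colour x (m⊔n≤o⇒m≤o K _ N≤x) _ τ∈ y x<y D₁x D₁y)
      ...   | α , α∉ , h<vα =
        inj₂ (below-⊂ B v α (m⊓n≤m (f x) (h x)) α∉ (≤-trans (m⊓n≤n (f x) (h x)) (<⇒≤ h<vα)))

refinement : ExcludedMiddle 0ℓ → ∀ T {k} (E : ℕ → ℕ → List (Vector k)) {D f g} →
             Infinite D → IsSeparator T f g → Stages.Refinement T E D f g
refinement em S E = RefinementS.refinement em E
refinement em B E = RefinementB.refinement em E

pairList : ∀ {A : Set} → ((x y : ℕ) → x < y → List⁺ A) → ℕ → ℕ → List A
pairList E x y with x <? y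
... | yes x<y = toList (E x y x<y)
... | no _ = []

pairList-< : ∀ {A : Set} (E : (x y : ℕ) → x < y → List⁺ A) {x y} (x<y : x < y) →
             pairList E x y ≡ toList (E x y x<y)
pairList-< E {x} {y} x<y with x <? y
... | yes x<y′ = cong (λ p → toList (E x y p)) (<-irrelevant x<y′ x<y)
... | no x≮y = ⊥-elim (x≮y x<y)

lemma5p8 : ExcludedMiddle 0ℓ → (T : Ty) → (k : ℕ)
    → (E : (x y : ℕ) → x < y → List⁺ (Vector k))
    → Σ (List (Subset k)) λ Θ → Σ (ℕ → Set) λ D → Σ (ℕ → ℕ) λ f → Σ (ℕ → ℕ) λ g →
        Infinite D × IsSeparator T f g ×
        (∀ x y → (x<y : x < y) → D x → D y →
          (∀ v → v ∈ toList (E x y x<y) → ∃ λ σ → σ ∈ Θ × LeOn T v σ (f x))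
          × (∀ σ → σ ∈ Θ → ∃ λ v → v ∈ toList (E x y x<y)
               × LeOn T v σ (f x) × NotLeOn T v (∁ σ) (g x)))
lemma5p8 em T k E =
  Θ , D , f , g , infinite , separator , λ x y x<y Dx Dy → covers x<y Dx Dy , witnesses x<y Dx Dy
  where
  open Stages T (pairList E)
  open Stage (iterate (refinement em T (pairList E)) (separator-exists T) (suc k))

  covers : ∀ {x y} (x<y : x < y) → D x → D y → ∀ v → v ∈ toList (E x y x<y) →
           ∃ λ σ → σ ∈ Θ × LeOn T v σ (f x)
  covers {x} {y} x<y Dx Dy v v∈ with covered x y x<y Dx Dy v (subst (v ∈_) (sym (pairList-< E x<y)) v∈)
  ... | inj₁ σ-covers = σ-covers
  ... | inj₂ k<∣below∣ = ⊥-elim (<⇒≱ k<∣below∣ (∣p∣≤n (below T v (f x))))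

  witnesses : ∀ {x y} (x<y : x < y) → D x → D y → ∀ σ → σ ∈ Θ →
              ∃ λ v → v ∈ toList (E x y x<y) × LeOn T v σ (f x) × NotLeOn T v (∁ σ) (g x)
  witnesses {x} {y} x<y Dx Dy σ σ∈ with witnessed σ σ∈ x y x<y Dx Dy
  ... | w , w∈ , le , nle = w , subst (w ∈_) (pairList-< E x<y) w∈ , le , nle
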